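{- Let $D$ be a $3$-anti-circulant digraph and let $S$ be a maximum stable set of $D$. Then for every $v\in B^+$ and every $u\in B^-$ we have $|N^-(v)\cap B^+|\le 1$ and $|N^+(u)\cap B^-|\le 1$.
   Context: Digraphs are finite, loopless, without multiple arcs (digons allowed); $u\to v$ means $uv$ is an arc; $N^-(v)$, $N^+(v)$ are the in- and out-neighbourhoods of $v$. A stable set is a set of pairwise non-adjacent vertices. An anti-$P_4$ is a set of four distinct vertices with $v_1\to v_2$, $v_3\to v_2$, $v_3\to v_4$; $D$ is $3$-anti-circulant if for every such anti-$P_4$, $v_4\to v_1$. For a maximum stable set $S$: $B^+$ is the set of vertices $v\notin S$ such that no vertex of $S$ dominates $v$; $B^-$ is the set of vertices $v\notin S$ that dominate no vertex of $S$; $B^{\pm}=V(D)\setminus(S\cup B^+\cup B^-)$ (vertices outside $S$ that both dominate and are dominated by vertices of $S$). -}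

module Defs where

open import Data.Nat using (ℕ; _≤_)
open import Data.Bool using (Bool; true; false; not; _∧_; _∨_)
open import Data.Fin using (Fin)
open import Data.Fin.Subset using (Subset; _∈_; _∉_; ∣_∣)
open import Data.Vec using (tabulate; lookup)
open import Data.Bool.ListAction using (any)
open import Data.List using (allFin)
open import Relation.Binary.PropositionalEquality using (_≡_)
open import Relation.Nullary using (¬_)
open import Data.Product using (_×_)

-- A digraph on vertex set Fin n: the arc relation is a Boolean matrix,
-- u → v iff arc u v ≡ true.  Loopless: no arc v v.  Digons allowed;
-- no multiple arcs (automatic).
record Digraph (n : ℕ) : Set where
  field
    arc      : Fin n → Fin n → Bool
    loopless : ∀ v → arc v v ≡ false

module _ {n : ℕ} (D : Digraph n) where
  open Digraph D

  _⟶_ : Fin n → Fin n → Set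
  u ⟶ v = arc u v ≡ true

  N⁻ : Fin n → Subset n
  N⁻ v = tabulate (λ u → arc u v)

  N⁺ : Fin n → Subset n
  N⁺ v = tabulate (λ u → arc v u)

  Stable : Subset n → Set
  Stable S = ∀ x y → x ∈ S → y ∈ S → ¬ (x ⟶ y)

  MaximumStable : Subset n → Set
  MaximumStable S = Stable S × (∀ T → Stable T → ∣ T ∣ ≤ ∣ S ∣)

  -- Anti-P4 v1 v2 v3 v4: four distinct vertices with v1→v2, v3→v2, v3→v4.
  -- 3-anti-circulant: every anti-P4 satisfies v4 → v1.
  ThreeAntiCirculant : Set
  ThreeAntiCirculant =
    ∀ v₁ v₂ v₃ v₄ →
    ¬ v₁ ≡ v₂ → ¬ v₁ ≡ v₃ → ¬ v₁ ≡ v₄ → ¬ v₂ ≡ v₃ → ¬ v₂ ≡ v₄ → ¬ v₃ ≡ v₄ →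
    v₁ ⟶ v₂ → v₃ ⟶ v₂ → v₃ ⟶ v₄ → v₄ ⟶ v₁

  someIn : Subset n → (Fin n → Bool) → Bool
  someIn S p = any (λ x → lookup S x ∧ p x) (allFin n)

  B⁺ : Subset n → Subset n
  B⁺ S = tabulate (λ v → not (lookup S v) ∧ not (someIn S (λ s → arc s v)))

  B⁻ : Subset n → Subset n
  B⁻ S = tabulate (λ v → not (lookup S v) ∧ not (someIn S (λ s → arc v s)))

-- Let x ≠ y be two in-neighbours of v lying in B⁺.  As y is dominated by no
-- vertex of S, maximality of S forces y to dominate some s ∈ S (otherwise
-- S ∪ {y} would be a larger stable set).  Then x → v ← y → s is an anti-P₄,
-- so s → x, contradicting x ∈ B⁺.  The statement about B⁻ is the same
-- statement for the reverse digraph.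
module Submission where

open import Defs
open import Data.Bool using (Bool; false; not; T)
open import Data.Bool.Properties using (T-≡; T-∧; T?)
open import Data.Fin using (Fin; _≟_)
open import Data.Fin.Subset using (Subset; _∈_; _∉_; _⊂_; _∩_; _∪_; ⁅_⁆; ∣_∣)
open import Data.Fin.Subset.Properties
  using (nonempty?; Empty-unique; ∣⊥∣≡0; ∣⁅x⁆∣≡1; x∈⁅x⁆; x∈⁅y⁆⇒x≡y; x∈⁅y⁆⇔x≡y;
         p⊆q⇒∣p∣≤∣q∣; p⊂q⇒∣p∣<∣q∣; p⊆p∪q; x∈p∪q⁺; x∈p∪q⁻; x∈p∩q⁻)
open import Data.List using (allFin)
open import Data.List.Membership.Propositional using (lose)
open import Data.List.Membership.Propositional.Properties using (∈-allFin)
open import Data.List.Relation.Unary.Any using (satisfied)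
open import Data.List.Relation.Unary.Any.Properties using (any⁺; any⁻)
open import Data.Nat using (ℕ; _≤_; z≤n)
open import Data.Nat.Properties using (<⇒≱; ≤-reflexive; ≤-trans; module ≤-Reasoning)
open import Data.Product using (_×_; _,_; proj₁; proj₂; ∃)
open import Data.Sum using (inj₁; inj₂)
open import Data.Vec using (tabulate)
open import Data.Vec.Properties using ([]=⇒lookup; lookup⇒[]=; lookup∘tabulate)
open import Function using (flip)
open import Function.Bundles using (Equivalence)
open import Relation.Binary.PropositionalEquality using (_≡_; _≢_; ≢-sym; refl; sym; trans; cong)
open import Relation.Nullary using (¬_; yes; no; contradiction)

open Equivalence using (to; from)

private
  variable
    n : ℕ

∈-tabulate⁻ : ∀ {f : Fin n → Bool} {x} → x ∈ tabulate f → T (f x)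
∈-tabulate⁻ {f = f} {x} x∈ = from T-≡ (trans (sym (lookup∘tabulate f x)) ([]=⇒lookup x∈))

T-not⇒¬T : ∀ {b} → T (not b) → ¬ T b
T-not⇒¬T {false} _ ()

subsingleton⇒∣p∣≤1 : ∀ {n} (p : Subset n) → (∀ {x y} → x ∈ p → y ∈ p → x ≡ y) → ∣ p ∣ ≤ 1
subsingleton⇒∣p∣≤1 {n} p unique with nonempty? p
... | yes (x , x∈p) = begin
  ∣ p ∣     ≤⟨ p⊆q⇒∣p∣≤∣q∣ (λ y∈p → from x∈⁅y⁆⇔x≡y (unique y∈p x∈p)) ⟩
  ∣ ⁅ x ⁆ ∣ ≡⟨ ∣⁅x⁆∣≡1 x ⟩
  1         ∎
  where open ≤-Reasoning
... | no empty = ≤-trans (≤-reflexive (trans (cong ∣_∣ (Empty-unique empty)) (∣⊥∣≡0 n))) z≤n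

module _ (D : Digraph n) where
  open Digraph D

  private
    infix 4 _↦_
    _↦_ : Fin n → Fin n → Set
    _↦_ = _⟶_ D

  ↦⇒≢ : ∀ {u v} → u ↦ v → u ≢ v
  ↦⇒≢ {u} u↦u refl = contradiction (trans (sym u↦u) (loopless u)) λ ()

  someIn⁺ : ∀ {S f s} → s ∈ S → T (f s) → T (someIn D S f)
  someIn⁺ {s = s} s∈S fs =
    any⁺ _ (lose (∈-allFin s) (from T-∧ (from T-≡ ([]=⇒lookup s∈S) , fs)))

  someIn⁻ : ∀ {S f} → T (someIn D S f) → ∃ λ s → s ∈ S × T (f s)
  someIn⁻ {S} t with satisfied (any⁻ _ (allFin n) t)
  ... | s , p with to T-∧ p
  ...   | s∈S , fs = s , lookup⇒[]= s S (to T-≡ s∈S) , fs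

  ∈B⁺⇒∉ : ∀ {S x} → x ∈ B⁺ D S → x ∉ S
  ∈B⁺⇒∉ x∈B⁺ x∈S =
    T-not⇒¬T (to T-∧ (∈-tabulate⁻ x∈B⁺) .proj₁) (from T-≡ ([]=⇒lookup x∈S))

  ∈B⁺⇒undominated : ∀ {S x s} → x ∈ B⁺ D S → s ∈ S → ¬ s ↦ x
  ∈B⁺⇒undominated x∈B⁺ s∈S s↦x =
    T-not⇒¬T (to T-∧ (∈-tabulate⁻ x∈B⁺) .proj₂) (someIn⁺ s∈S (from T-≡ s↦x))

  stable-∪⁅⁆ : ∀ {S y} → Stable D S →
    (∀ {s} → s ∈ S → ¬ s ↦ y) → (∀ {s} → s ∈ S → ¬ y ↦ s) → Stable D (S ∪ ⁅ y ⁆)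
  stable-∪⁅⁆ {S} {y} stable undominated nondominating a b a∈ b∈ a↦b
    with x∈p∪q⁻ S ⁅ y ⁆ a∈ | x∈p∪q⁻ S ⁅ y ⁆ b∈
  ... | inj₁ a∈S | inj₁ b∈S = stable a b a∈S b∈S a↦b
  ... | inj₁ a∈S | inj₂ b∈y with refl ← x∈⁅y⁆⇒x≡y y b∈y = undominated a∈S a↦b
  ... | inj₂ a∈y | inj₁ b∈S with refl ← x∈⁅y⁆⇒x≡y y a∈y = nondominating b∈S a↦b
  ... | inj₂ a∈y | inj₂ b∈y = ↦⇒≢ a↦b (trans (x∈⁅y⁆⇒x≡y y a∈y) (sym (x∈⁅y⁆⇒x≡y y b∈y)))

  maximumStable⇒dominates : ∀ {S y} → MaximumStable D S → y ∉ S →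
    (∀ {s} → s ∈ S → ¬ s ↦ y) → ∃ λ s → s ∈ S × y ↦ s
  maximumStable⇒dominates {S} {y} (stable , maximum) y∉S undominated
    with T? (someIn D S (arc y))
  ... | yes t = let s , s∈S , y↦s = someIn⁻ t in s , s∈S , to T-≡ y↦s
  ... | no ¬t = contradiction (maximum (S ∪ ⁅ y ⁆) (stable-∪⁅⁆ stable undominated nondominating))
                              (<⇒≱ (p⊂q⇒∣p∣<∣q∣ S⊂S∪y))
    where
    nondominating : ∀ {s} → s ∈ S → ¬ y ↦ s
    nondominating s∈S y↦s = ¬t (someIn⁺ s∈S (from T-≡ y↦s))
    S⊂S∪y : S ⊂ S ∪ ⁅ y ⁆
    S⊂S∪y = p⊆p∪q ⁅ y ⁆ , y , x∈p∪q⁺ (inj₂ (x∈⁅x⁆ y)) , y∉S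

  ∈N⁻⇒↦ : ∀ {u v} → u ∈ N⁻ D v → u ↦ v
  ∈N⁻⇒↦ u∈N⁻ = to T-≡ (∈-tabulate⁻ u∈N⁻)

  B⁺-in-neighbours-unique : ∀ {S v x y} → ThreeAntiCirculant D → MaximumStable D S →
    v ∈ B⁺ D S → x ↦ v → x ∈ B⁺ D S → y ↦ v → y ∈ B⁺ D S → x ≡ y
  B⁺-in-neighbours-unique {S} {v} {x} {y} anti-circulant maximum v∈B⁺ x↦v x∈B⁺ y↦v y∈B⁺
    with x ≟ y | maximumStable⇒dominates maximum (∈B⁺⇒∉ y∈B⁺) (∈B⁺⇒undominated y∈B⁺)
  ... | yes x≡y | _ = x≡y
  ... | no x≢y | s , s∈S , y↦s = contradiction s↦x (∈B⁺⇒undominated x∈B⁺ s∈S)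
    where
    ≢s : ∀ {w} → w ∈ B⁺ D S → w ≢ s
    ≢s w∈B⁺ refl = ∈B⁺⇒∉ w∈B⁺ s∈S
    s↦x : s ↦ x
    s↦x = anti-circulant x v y s (↦⇒≢ x↦v) x≢y (≢s x∈B⁺) (≢-sym (↦⇒≢ y↦v)) (≢s v∈B⁺) (≢s y∈B⁺)
                         x↦v y↦v y↦s

  ∣N⁻∩B⁺∣≤1 : ∀ {S} → ThreeAntiCirculant D → MaximumStable D S →
    ∀ v → v ∈ B⁺ D S → ∣ N⁻ D v ∩ B⁺ D S ∣ ≤ 1
  ∣N⁻∩B⁺∣≤1 {S} anti-circulant maximum v v∈B⁺ = subsingleton⇒∣p∣≤1 _ unique
    where
    unique : ∀ {x y} → x ∈ N⁻ D v ∩ B⁺ D S → y ∈ N⁻ D v ∩ B⁺ D S → x ≡ y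
    unique x∈ y∈ with x∈p∩q⁻ _ _ x∈ | x∈p∩q⁻ _ _ y∈
    ... | x∈N⁻ , x∈B⁺ | y∈N⁻ , y∈B⁺ =
      B⁺-in-neighbours-unique anti-circulant maximum v∈B⁺ (∈N⁻⇒↦ x∈N⁻) x∈B⁺ (∈N⁻⇒↦ y∈N⁻) y∈B⁺

reverse : Digraph n → Digraph n
reverse D = record { arc = flip (Digraph.arc D) ; loopless = Digraph.loopless D }

reverse-stable : ∀ (D : Digraph n) {S} → Stable D S → Stable (reverse D) S
reverse-stable D stable x y x∈S y∈S = stable y x y∈S x∈S

module _ (D : Digraph n) where

  reverse-threeAntiCirculant : ThreeAntiCirculant D → ThreeAntiCirculant (reverse D)
  reverse-threeAntiCirculant anti-circulant
    v₁ v₂ v₃ v₄ v₁≢v₂ v₁≢v₃ v₁≢v₄ v₂≢v₃ v₂≢v₄ v₃≢v₄ v₂⟶v₁ v₂⟶v₃ v₄⟶v₃ =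
    anti-circulant v₄ v₃ v₂ v₁
      (≢-sym v₃≢v₄) (≢-sym v₂≢v₄) (≢-sym v₁≢v₄) (≢-sym v₂≢v₃) (≢-sym v₁≢v₃) (≢-sym v₁≢v₂)
      v₄⟶v₃ v₂⟶v₃ v₂⟶v₁

  -- reverse (reverse D) is D up to η, so reverse-stable also goes backwards.
  reverse-maximumStable : ∀ {S} → MaximumStable D S → MaximumStable (reverse D) S
  reverse-maximumStable (stable , maximum) =
    reverse-stable D stable , λ U U-stable → maximum U (reverse-stable (reverse D) U-stable)

lemma9 : ∀ {n : ℕ} (D : Digraph n) (S : Subset n) →
    ThreeAntiCirculant D → MaximumStable D S →
    (∀ v → v ∈ B⁺ D S → ∣ N⁻ D v ∩ B⁺ D S ∣ ≤ 1) ×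
    (∀ u → u ∈ B⁻ D S → ∣ N⁺ D u ∩ B⁻ D S ∣ ≤ 1)
-- B⁻ D S and N⁺ D u are, by definition, B⁺ (reverse D) S and N⁻ (reverse D) u.
lemma9 D S anti-circulant maximum =
  ∣N⁻∩B⁺∣≤1 D anti-circulant maximum ,
  ∣N⁻∩B⁺∣≤1 (reverse D) (reverse-threeAntiCirculant D anti-circulant) (reverse-maximumStable D maximum)
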